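{- Let $t\ge6$ be an integer and let $\lambda\in\mathcal{DS}(t)$ satisfy $|\lambda|=\max\{|\mu|:\mu\in\mathcal{DS}(t)\}$. Write $MD(\lambda)=\{h_1>h_2>\dots>h_k\}$ and $d_i=h_i-h_{i+1}$. Let $Q_t^{l}=\big(\{1,3,\dots,2t-1\}\setminus\{t,t+1\}\big)\cap[t+2,2t-1]$. If for some $1\le i\le k-1$ we have $h_i,h_{i+1}\in Q_t^{l}$ and $d_i=6$, then $2t+4-h_i\in MD(\lambda)$.
   Context: Hook length of box $(i,j)$ of a Young diagram: number of boxes to its right in row $i$, plus number below it in column $j$, plus one. A partition is a $t$-core if no hook length is divisible by $t$; a $(t,t+1)$-core if it is both a $t$-core and a $(t+1)$-core. Self-conjugate: Young diagram symmetric about the main diagonal. $|\lambda|$ is the sum of the parts. $s(\lambda)$ is the largest $s$ such that $\lambda$ has at least $s$ parts $\ge s$. $MD(\lambda)$ is the set of hook lengths of the main-diagonal boxes $(i,i)$, $1\le i\le s(\lambda)$. $\mathcal{DS}(t)$ is the set of self-conjugate $(t,t+1)$-core partitions whose first $s(\lambda)$ parts are pairwise distinct, including the empty partition. -}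

module Defs where

open import Data.Nat using (ℕ; zero; suc; _+_; _*_; _∸_; _≤_; _<_; _≤ᵇ_; _<ᵇ_)
open import Data.Nat.Divisibility using (_∣_)
open import Data.Bool using (Bool; true; false; if_then_else_)
open import Data.List using (List; []; _∷_; length; filterᵇ)
open import Data.Nat.ListAction using (sum)
open import Data.List.Relation.Unary.All using (All)
open import Data.List.Relation.Unary.Linked using (Linked)
open import Data.Product using (_×_; ∃)
open import Relation.Nullary using (¬_)
open import Relation.Binary.PropositionalEquality using (_≡_; _≢_)

-- A partition is a list of its parts λ₁ ≥ λ₂ ≥ … (all positive).
-- Rows/columns are indexed from 0 below.
IsPartition : List ℕ → Set
IsPartition λs = Linked (λ a b → b ≤ a) λs × All (λ a → 0 < a) λs

part : List ℕ → ℕ → ℕ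
part []       _       = 0
part (x ∷ _)  zero    = x
part (_ ∷ xs) (suc i) = part xs i

size : List ℕ → ℕ
size = sum

numGe : List ℕ → ℕ → ℕ
numGe λs s = length (filterᵇ (λ a → s ≤ᵇ a) λs)

conj : List ℕ → ℕ → ℕ
conj λs j = numGe λs (suc j)

InDiagram : List ℕ → ℕ → ℕ → Set
InDiagram λs i j = j < part λs i

-- hook length of box (i,j): boxes to the right + boxes below + 1
hook : List ℕ → ℕ → ℕ → ℕ
hook λs i j = (part λs i ∸ suc j) + (conj λs j ∸ suc i) + 1

IsCore : ℕ → List ℕ → Set
IsCore t λs = ∀ i j → InDiagram λs i j → ¬ (t ∣ hook λs i j)

SelfConjugate : List ℕ → Set
SelfConjugate λs = ∀ j → conj λs j ≡ part λs j

-- s(λ): the largest s (necessarily s ≤ length λ) such that λ has at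
-- least s parts ≥ s
durfeeFrom : List ℕ → ℕ → ℕ
durfeeFrom λs zero    = zero
durfeeFrom λs (suc n) = if suc n ≤ᵇ numGe λs (suc n) then suc n else durfeeFrom λs n

s : List ℕ → ℕ
s λs = durfeeFrom λs (length λs)

FirstSDistinct : List ℕ → Set
FirstSDistinct λs = ∀ i j → i < s λs → j < s λs → i ≢ j → part λs i ≢ part λs j

DS : ℕ → List ℕ → Set
DS t λs = IsPartition λs × IsCore t λs × IsCore (suc t) λs
        × SelfConjugate λs × FirstSDistinct λs

InMD : List ℕ → ℕ → Set
InMD λs h = ∃ λ i → i < s λs × hook λs i i ≡ h

InQl : ℕ → ℕ → Set
InQl t h = (∃ λ k → h ≡ 2 * k + 1) × 1 ≤ h × h ≤ 2 * t ∸ 1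
         × h ≢ t × h ≢ suc t × t + 2 ≤ h

-- Index rows from 0 and put r = i + 1, q = λ_r, c = q − r. On the diagonal of a
-- self-conjugate partition h_a = 2(λ_a − a) − 1, so h_r = 2c − 1, and d_i = 6 means
-- λ_i = q + 2; hence λ_q = r, and adding the boxes (r, q) and (q, r) to λ gives a
-- self-conjugate μ with distinct diagonal parts and |μ| = |λ| + 2. The new hooks of μ
-- are 1, h_r + 2, the hooks of row r of λ increased by one, and hooks below t in row q
-- (every member of DS(t) has λ_0 ≤ t). The bounds t + 2 ≤ h_r < h_i ≤ 2t − 1 keep all
-- of them away from t and t + 1, except that a hook in row r equals t exactly at a
-- column j with λ_j + c = t + j. By maximality of λ such a j exists, and then
-- h_j = 2t − 2c − 1 = 2t + 4 − h_i.

module Submission where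

open import Defs
open import Data.Nat using (ℕ; zero; suc; _+_; _*_; _∸_; _≤_; _<_; _≤ᵇ_; z≤n; s≤s; s≤s⁻¹)
open import Data.Nat.Properties
open import Data.Nat.Divisibility using (_∣_; _∤_; divides; ∣-refl)
open import Data.Nat.Tactic.RingSolver using (solve-∀)
open import Data.Bool using (true; false)
open import Data.Unit using (tt)
open import Data.List using (List; []; _∷_; length)
open import Data.List.Relation.Unary.All using (All; _∷_)
open import Data.List.Relation.Unary.Linked using (Linked; []; [-]; _∷_; tail)
open import Data.Fin using (Fin; toℕ; fromℕ<)
open import Data.Fin.Properties using (any?; toℕ-fromℕ<)
open import Data.Product using (_×_; _,_; ∃; proj₁; proj₂)
open import Data.Sum using (_⊎_; inj₁; inj₂; [_,_]′)
open import Data.Empty using (⊥-elim)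
open import Function using (_∘_)
open import Relation.Nullary using (¬_; yes; no; contradiction)
open import Relation.Unary using (Decidable)
open import Relation.Binary.PropositionalEquality
open import Relation.Binary.Definitions using (tri<; tri≈; tri>)

Descending : List ℕ → Set
Descending = Linked (λ a b → b ≤ a)

part-step : ∀ {L} → Descending L → ∀ k → part L (suc k) ≤ part L k
part-step []            k       = z≤n
part-step [-]           k       = z≤n
part-step (y≤x ∷ _)     zero    = y≤x
part-step (_ ∷ desc)    (suc k) = part-step desc k

part-antitone : ∀ {L} → Descending L → ∀ {a b} → a ≤ b → part L b ≤ part L a
part-antitone desc {b = zero}  z≤n = ≤-refl
part-antitone desc {b = suc b} a≤1+b with m≤n⇒m<n∨m≡n a≤1+b
... | inj₁ a<1+b = ≤-trans (part-step desc b) (part-antitone desc (s≤s⁻¹ a<1+b))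
... | inj₂ refl  = ≤-refl

descending-from-part-step : ∀ L → (∀ k → part L (suc k) ≤ part L k) → Descending L
descending-from-part-step []           step = []
descending-from-part-step (x ∷ [])     step = [-]
descending-from-part-step (x ∷ y ∷ ys) step =
  step 0 ∷ descending-from-part-step (y ∷ ys) (λ k → step (suc k))

part-pos⇒<length : ∀ L k → 0 < part L k → k < length L
part-pos⇒<length (x ∷ L) zero    _   = s≤s z≤n
part-pos⇒<length (x ∷ L) (suc k) pos = s≤s (part-pos⇒<length L k pos)

conj-∷-< : ∀ x xs j → j < x → conj (x ∷ xs) j ≡ suc (conj xs j)
conj-∷-< x xs j j<x with suc j ≤ᵇ x | ≤⇒≤ᵇ j<x
... | true | _ = refl

conj-∷-≮ : ∀ x xs j → ¬ (j < x) → conj (x ∷ xs) j ≡ conj xs j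
conj-∷-≮ x xs j j≮x with suc j ≤ᵇ x | ≤ᵇ⇒≤ (suc j) x
... | false | _      = refl
... | true  | j<x = ⊥-elim (j≮x (j<x tt))

<conj⇒<part : ∀ {L} → Descending L → ∀ i j → i < conj L j → j < part L i
<conj⇒<part {[]}     desc i j ()
<conj⇒<part {x ∷ xs} desc i j i<c with j <? x
<conj⇒<part {x ∷ xs} desc zero    j i<c | yes j<x = j<x
<conj⇒<part {x ∷ xs} desc (suc i) j i<c | yes j<x rewrite conj-∷-< x xs j j<x =
  <conj⇒<part (tail desc) i j (s≤s⁻¹ i<c)
<conj⇒<part {x ∷ xs} desc i       j i<c | no j≮x rewrite conj-∷-≮ x xs j j≮x =
  ⊥-elim (j≮x (<-≤-trans (<conj⇒<part (tail desc) i j i<c) (part-antitone desc (z≤n {suc i}))))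

<part⇒<conj : ∀ {L} → Descending L → ∀ i j → j < part L i → i < conj L j
<part⇒<conj {x ∷ xs} desc i j j<p with j <? x
<part⇒<conj {x ∷ xs} desc zero    j j<p | yes j<x rewrite conj-∷-< x xs j j<x = s≤s z≤n
<part⇒<conj {x ∷ xs} desc (suc i) j j<p | yes j<x rewrite conj-∷-< x xs j j<x =
  s≤s (<part⇒<conj (tail desc) i j j<p)
<part⇒<conj {x ∷ xs} desc i       j j<p | no j≮x =
  ⊥-elim (j≮x (<-≤-trans j<p (part-antitone desc (z≤n {i}))))

StrictDiagonal : List ℕ → Set
StrictDiagonal L = ∀ {a b} → a < b → b < part L b → part L b < part L a

module _ {L : List ℕ} (desc : Descending L) where

  <durfeeFrom⇒<part : ∀ n a → a < durfeeFrom L n → a < part L a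
  <durfeeFrom⇒<part (suc n) a a<d with suc n ≤ᵇ conj L n | ≤ᵇ⇒≤ (suc n) (conj L n)
  ... | true  | n<c = <-≤-trans (≤-<-trans (s≤s⁻¹ a<d) (<conj⇒<part desc n n (n<c tt)))
                                (part-antitone desc (s≤s⁻¹ a<d))
  ... | false | _   = <durfeeFrom⇒<part n a a<d

  <part⇒<durfeeFrom : ∀ n a → a < n → a < part L a → a < durfeeFrom L n
  <part⇒<durfeeFrom (suc n) a a<1+n a<p with suc n ≤ᵇ conj L n | ≤⇒≤ᵇ {suc n} {conj L n}
  ... | true  | _     = a<1+n
  ... | false | n<c⇒ with m≤n⇒m<n∨m≡n a<1+n
  ...   | inj₁ a<n  = <part⇒<durfeeFrom n a (s≤s⁻¹ a<n) a<p
  ...   | inj₂ refl with n<c⇒ (<part⇒<conj desc n n a<p)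
  ...     | ()

  <s⇒<part : ∀ {a} → a < s L → a < part L a
  <s⇒<part = <durfeeFrom⇒<part (length L) _

  <part⇒<s : ∀ {a} → a < part L a → a < s L
  <part⇒<s {a} a<p = <part⇒<durfeeFrom (length L) a (part-pos⇒<length L a (≤-<-trans z≤n a<p)) a<p

  firstSDistinct⇒strictDiagonal : FirstSDistinct L → StrictDiagonal L
  firstSDistinct⇒strictDiagonal distinct {a} {b} a<b b<pb =
    ≤∧≢⇒< (part-antitone desc (<⇒≤ a<b))
          (λ pb≡pa → distinct a b (<part⇒<s a<pa) (<part⇒<s b<pb) (<⇒≢ a<b) (sym pb≡pa))
    where
    a<pa : a < part L a
    a<pa = <-trans a<b (<-≤-trans b<pb (part-antitone desc (<⇒≤ a<b)))

  strictDiagonal⇒firstSDistinct : StrictDiagonal L → FirstSDistinct L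
  strictDiagonal⇒firstSDistinct strict a b a<s b<s a≢b pa≡pb with <-cmp a b
  ... | tri< a<b _ _ = <⇒≢ (strict a<b (<s⇒<part b<s)) (sym pa≡pb)
  ... | tri≈ _ a≡b _ = a≢b a≡b
  ... | tri> _ _ b<a = <⇒≢ (strict b<a (<s⇒<part a<s)) pa≡pb

  selfConjugate-from-transpose : (∀ {i j} → j < part L i → i < part L j) → SelfConjugate L
  selfConjugate-from-transpose transpose j = ≤-antisym
    (≮⇒≥ λ pj<c → <-irrefl refl (transpose (<conj⇒<part desc (part L j) j pj<c)))
    (≮⇒≥ λ c<pj → <-irrefl refl (<part⇒<conj desc (conj L j) j (transpose c<pj)))

  module _ (sc : SelfConjugate L) where

    transpose : ∀ {i j} → j < part L i → i < part L j
    transpose {i} {j} j<pi = subst (i <_) (sc j) (<part⇒<conj desc i j j<pi)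

    hook-sum : ∀ {i j} → j < part L i → hook L i j + (i + j + 1) ≡ part L i + part L j
    hook-sum {i} {j} j<pi = begin
      (part L i ∸ suc j) + (conj L j ∸ suc i) + 1 + (i + j + 1)
        ≡⟨ cong (λ c → (part L i ∸ suc j) + (c ∸ suc i) + 1 + (i + j + 1)) (sc j) ⟩
      (part L i ∸ suc j) + (part L j ∸ suc i) + 1 + (i + j + 1)
        ≡⟨ regroup (part L i ∸ suc j) (part L j ∸ suc i) i j ⟩
      (part L i ∸ suc j) + suc j + ((part L j ∸ suc i) + suc i)
        ≡⟨ cong₂ _+_ (m∸n+n≡m j<pi) (m∸n+n≡m (transpose j<pi)) ⟩
      part L i + part L j ∎
      where
      open ≡-Reasoning
      regroup : ∀ u v i j → u + v + 1 + (i + j + 1) ≡ u + suc j + (v + suc i)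
      regroup = solve-∀

    column-length : ∀ {x b} → x < part L b → ¬ x < part L (suc b) → part L x ≡ suc b
    column-length x<pb x≮pb+1 = ≤-antisym (≮⇒≥ (λ b<px → x≮pb+1 (transpose b<px))) (transpose x<pb)

    hook-sym : ∀ {i j} → j < part L i → hook L i j ≡ hook L j i
    hook-sym {i} {j} j<pi = +-cancelʳ-≡ (i + j + 1) _ _ (begin
      hook L i j + (i + j + 1)  ≡⟨ hook-sum j<pi ⟩
      part L i + part L j       ≡⟨ +-comm (part L i) (part L j) ⟩
      part L j + part L i       ≡⟨ sym (hook-sum (transpose j<pi)) ⟩
      hook L j i + (j + i + 1)  ≡⟨ cong (λ x → hook L j i + (x + 1)) (+-comm j i) ⟩
      hook L j i + (i + j + 1)  ∎)
      where open ≡-Reasoning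

hook-pos : ∀ L i j → 0 < hook L i j
hook-pos L i j = subst (0 <_) (+-comm 1 _) (s≤s z≤n)

last-crossing : (A : ℕ → Set) → Decidable A → ∀ n → A 0 → ¬ A n → ∃ λ b → b < n × A b × ¬ A (suc b)
last-crossing A A? zero    A0 ¬An = ⊥-elim (¬An A0)
last-crossing A A? (suc n) A0 ¬A1+n with A? n
... | yes An  = n , ≤-refl , An , ¬A1+n
... | no  ¬An with last-crossing A A? n A0 ¬An
...   | b , b<n , Ab , ¬A1+b = b , m<n⇒m<1+n b<n , Ab , ¬A1+b

∤-below-double : ∀ {d v} → 0 < v → v < d + d → v ≢ d → d ∤ v
∤-below-double {d} 0<v v<2d v≢d (divides zero          refl) = <-irrefl refl 0<v
∤-below-double {d} 0<v v<2d v≢d (divides (suc zero)    refl) = v≢d (+-identityʳ d)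
∤-below-double {d} 0<v v<2d v≢d (divides (suc (suc k)) refl) =
  <-irrefl refl (<-≤-trans v<2d (subst (d + d ≤_) (+-assoc d d (k * d)) (m≤m+n (d + d) (k * d))))

+-double-injective : ∀ {x y} → x + x ≡ y + y → x ≡ y
+-double-injective {x} {y} x+x≡y+y with <-cmp x y
... | tri< x<y _ _ = ⊥-elim (<⇒≢ (+-mono-< x<y x<y) x+x≡y+y)
... | tri≈ _ x≡y _ = x≡y
... | tri> _ _ y<x = ⊥-elim (<⇒≢ (+-mono-< y<x y<x) (sym x+x≡y+y))

Avoids : ℕ → ℕ → Set
Avoids t v = t ∤ v × suc t ∤ v

avoids-below-double : ∀ {t v} → 0 < v → v < t + t → v ≢ t → v ≢ suc t → Avoids t v
avoids-below-double {t} 0<v v<2t v≢t v≢1+t =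
  ∤-below-double 0<v v<2t v≢t , ∤-below-double 0<v (<-trans v<2t (+-mono-< (n<1+n t) (n<1+n t))) v≢1+t

avoids-below : ∀ {t v} → 0 < v → v < t → Avoids t v
avoids-below {t} 0<v v<t = avoids-below-double 0<v (<-≤-trans v<t (m≤m+n t t)) (<⇒≢ v<t) (<⇒≢ (m<n⇒m<1+n v<t))

hook≤1+t⇒<t : ∀ {t L i j} → IsCore t L → IsCore (suc t) L → j < part L i → hook L i j ≤ suc t → hook L i j < t
hook≤1+t⇒<t {t} {L} {i} {j} core core′ j<pi h≤1+t with m≤n⇒m<n∨m≡n h≤1+t
... | inj₂ h≡1+t = ⊥-elim (core′ i j j<pi (subst (suc t ∣_) (sym h≡1+t) ∣-refl))
... | inj₁ h<1+t with m≤n⇒m<n∨m≡n (s≤s⁻¹ h<1+t)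
...   | inj₁ h<t  = h<t
...   | inj₂ h≡t  = ⊥-elim (core i j j<pi (subst (t ∣_) (sym h≡t) ∣-refl))

module _ {t : ℕ} {L : List ℕ} (desc : Descending L) (sc : SelfConjugate L) (strictDiag : StrictDiagonal L)
         (core : IsCore t L) (core′ : IsCore (suc t) L) where

  first-part≤ : 1 ≤ t → part L 0 ≤ t
  first-part≤ 1≤t with part L 0 ≤? t
  ... | yes m≤t = m≤t
  ... | no  m≰t = equal-parts-in-durfee (last-crossing A (λ b → 3 + t + b ≤? part L b + m) m A0 ¬Am)
    where
    open ≤-Reasoning
    m : ℕ
    m = part L 0
    t<m : t < m
    t<m = ≰⇒> m≰t
    pm≡0 : part L m ≡ 0
    pm≡0 = n≤0⇒n≡0 (≮⇒≥ (λ 0<pm → <-irrefl refl (transpose desc sc 0<pm)))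
    -- A b says that the first-row hook at column b is at least t + 2
    A : ℕ → Set
    A b = 3 + t + b ≤ part L b + m
    A0 : A 0
    A0 = subst (_≤ m + m) (lemma t) (+-mono-≤ t<m (≤-trans (s≤s 1≤t) t<m))
      where
      lemma : ∀ t → suc t + 2 ≡ 3 + t + 0
      lemma = solve-∀
    ¬Am : ¬ A m
    ¬Am 3+t+m≤pm+m with +-cancelʳ-≤ m (3 + t) 0 (subst (λ x → 3 + t + m ≤ x + m) pm≡0 3+t+m≤pm+m)
    ... | ()
    -- where the first-row hooks jump over t and t+1, two columns a, a+1 inside
    -- the Durfee square have the same length
    equal-parts-in-durfee : (∃ λ b → b < m × A b × ¬ A (suc b)) → part L 0 ≤ t
    equal-parts-in-durfee (b , b<m , Ab , ¬A1+b) =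
      ⊥-elim (<-irrefl (trans pa+1≡ (sym pa≡)) (strictDiag (n<1+n a) a+1-in-durfee))
      where
      a : ℕ
      a = part L (suc b)
      a+m≤ : a + m ≤ t + suc b
      a+m≤ with suc b <? m
      ... | yes 1+b<m = begin
          a + m                 ≡⟨ +-comm a m ⟩
          m + a                 ≡⟨ sym (hook-sum desc sc 1+b<m) ⟩
          h + (suc b + 1)       ≡⟨ shift h b ⟩
          suc h + suc b         ≤⟨ +-monoˡ-≤ (suc b) (hook≤1+t⇒<t {L = L} core core′ 1+b<m h≤1+t) ⟩
          t + suc b             ∎
        where
        h : ℕ
        h = hook L 0 (suc b)
        shift : ∀ h b → h + (suc b + 1) ≡ suc h + suc b
        shift = solve-∀
        rearrange : ∀ t b → 3 + t + suc b ≡ suc (suc t) + (suc b + 1)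
        rearrange = solve-∀
        h≤1+t : h ≤ suc t
        h≤1+t = ≤-pred (+-cancelʳ-≤ (suc b + 1) (suc h) (suc (suc t)) (begin
          suc h + (suc b + 1)   ≡⟨ cong suc (trans (hook-sum desc sc 1+b<m) (+-comm m a)) ⟩
          suc (a + m)           ≤⟨ ≰⇒> ¬A1+b ⟩
          3 + t + suc b         ≡⟨ rearrange t b ⟩
          suc (suc t) + (suc b + 1) ∎))
      ... | no  1+b≮m with m≤n⇒m<n∨m≡n b<m
      ...   | inj₁ 1+b<m = ⊥-elim (1+b≮m 1+b<m)
      ...   | inj₂ 1+b≡m = begin
          a + m                 ≡⟨ cong (_+ m) (trans (cong (part L) 1+b≡m) pm≡0) ⟩
          m                     ≡⟨ sym 1+b≡m ⟩
          suc b                 ≤⟨ m≤n+m (suc b) t ⟩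
          t + suc b             ∎
      a+2≤pb : a + 2 ≤ part L b
      a+2≤pb = +-cancelʳ-≤ m (a + 2) (part L b) (begin
          a + 2 + m             ≡⟨ +-comm (a + 2) m ⟩
          m + (a + 2)           ≡⟨ sym (+-assoc m a 2) ⟩
          m + a + 2             ≡⟨ cong (_+ 2) (+-comm m a) ⟩
          a + m + 2             ≤⟨ +-monoˡ-≤ 2 a+m≤ ⟩
          t + suc b + 2         ≡⟨ rearrange t b ⟩
          3 + t + b             ≤⟨ Ab ⟩
          part L b + m          ∎)
        where
        rearrange : ∀ t b → t + suc b + 2 ≡ 3 + t + b
        rearrange = solve-∀
      pa≡ : part L a ≡ suc b
      pa≡ = column-length desc sc (<-≤-trans (m<m+n a (s≤s z≤n)) a+2≤pb) (<-irrefl refl)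
      pa+1≡ : part L (suc a) ≡ suc b
      pa+1≡ = column-length desc sc (subst (_≤ part L b) (+-comm a 2) a+2≤pb) (λ a+1<a → <-asym a+1<a (n<1+n a))
      a≤b : a ≤ b
      a≤b = +-cancelʳ-≤ (suc t) a b (begin
          a + suc t             ≤⟨ +-monoʳ-≤ a t<m ⟩
          a + m                 ≤⟨ a+m≤ ⟩
          t + suc b             ≡⟨ +-comm t (suc b) ⟩
          suc b + t             ≡⟨ sym (+-suc b t) ⟩
          b + suc t             ∎)
      a≢b : a ≢ b
      a≢b a≡b = 1+n≢n (trans (sym pa+1≡) (trans (cong (part L ∘ suc) a≡b) a≡b))
      a+1-in-durfee : suc a < part L (suc a)
      a+1-in-durfee = subst (suc a <_) (sym pa+1≡) (s≤s (≤∧≢⇒< a≤b a≢b))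

incAt : ℕ → List ℕ → List ℕ
incAt _       []       = []
incAt zero    (x ∷ xs) = suc x ∷ xs
incAt (suc k) (x ∷ xs) = x ∷ incAt k xs

part-incAt-≡ : ∀ L k → k < length L → part (incAt k L) k ≡ suc (part L k)
part-incAt-≡ (x ∷ L) zero    _         = refl
part-incAt-≡ (x ∷ L) (suc k) (s≤s k<n) = part-incAt-≡ L k k<n

part-incAt-≢ : ∀ L k j → j ≢ k → part (incAt k L) j ≡ part L j
part-incAt-≢ []      k       j       j≢k = refl
part-incAt-≢ (x ∷ L) zero    zero    j≢k = ⊥-elim (j≢k refl)
part-incAt-≢ (x ∷ L) zero    (suc j) j≢k = refl
part-incAt-≢ (x ∷ L) (suc k) zero    j≢k = refl
part-incAt-≢ (x ∷ L) (suc k) (suc j) j≢k = part-incAt-≢ L k j (j≢k ∘ cong suc)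

length-incAt : ∀ L k → length (incAt k L) ≡ length L
length-incAt []      k       = refl
length-incAt (x ∷ L) zero    = refl
length-incAt (x ∷ L) (suc k) = cong suc (length-incAt L k)

size-incAt : ∀ L k → k < length L → size (incAt k L) ≡ suc (size L)
size-incAt (x ∷ L) zero    _         = refl
size-incAt (x ∷ L) (suc k) (s≤s k<n) = trans (cong (x +_) (size-incAt L k k<n)) (+-suc x (size L))

All-pos-incAt : ∀ L k → All (0 <_) L → All (0 <_) (incAt k L)
All-pos-incAt []      k       pos         = pos
All-pos-incAt (x ∷ L) zero    (_ ∷ pos)   = s≤s z≤n ∷ pos
All-pos-incAt (x ∷ L) (suc k) (px ∷ pos)  = px ∷ All-pos-incAt L k pos

module AddSymmetricCorners {L : List ℕ} (desc : Descending L) (sc : SelfConjugate L)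
         (strictDiag : StrictDiagonal L) (i : ℕ)
         (r<q : suc i < part L (suc i)) (q+1<pi : suc (part L (suc i)) < part L i) where

  r q : ℕ
  r = suc i
  q = part L r

  pq≡r : part L q ≡ r
  pq≡r = column-length desc sc (<-trans (n<1+n q) q+1<pi) (<-irrefl refl)

  r<length : r < length L
  r<length = part-pos⇒<length L r (≤-<-trans z≤n r<q)

  q<length : q < length L
  q<length = part-pos⇒<length L q (subst (0 <_) (sym pq≡r) (s≤s z≤n))

  μ : List ℕ
  μ = incAt q (incAt r L)

  part-μ-r : part μ r ≡ suc q
  part-μ-r = trans (part-incAt-≢ (incAt r L) q r (<⇒≢ r<q)) (part-incAt-≡ L r r<length)

  part-μ-q : part μ q ≡ suc r
  part-μ-q = trans (part-incAt-≡ (incAt r L) q (subst (q <_) (sym (length-incAt L r)) q<length))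
                   (cong suc (trans (part-incAt-≢ L r q (<⇒≢ r<q ∘ sym)) pq≡r))

  part-μ-other : ∀ {k} → k ≢ r → k ≢ q → part μ k ≡ part L k
  part-μ-other {k} k≢r k≢q = trans (part-incAt-≢ (incAt r L) q k k≢q) (part-incAt-≢ L r k k≢r)

  part≤part-μ : ∀ k → part L k ≤ part μ k
  part≤part-μ k with k ≟ r | k ≟ q
  ... | yes refl | _       = subst (q ≤_) (sym part-μ-r) (n≤1+n q)
  ... | no _     | yes refl = subst₂ _≤_ (sym pq≡r) (sym part-μ-q) (n≤1+n r)
  ... | no k≢r   | no k≢q  = ≤-reflexive (sym (part-μ-other k≢r k≢q))

  descending-μ : Descending μ
  descending-μ = descending-from-part-step μ step
    where
    step : ∀ k → part μ (suc k) ≤ part μ k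
    step k with suc k ≟ r | suc k ≟ q
    ... | yes refl | _ = subst (_≤ part μ i) (sym part-μ-r) (≤-trans (<⇒≤ q+1<pi) (part≤part-μ i))
    ... | no _ | yes k+1≡q rewrite k+1≡q =
      subst (_≤ part μ k) (sym part-μ-q)
            (≤-trans (transpose desc sc (subst (k <_) k+1≡q (n<1+n k))) (part≤part-μ k))
    ... | no k+1≢r | no k+1≢q =
      subst (_≤ part μ k) (sym (part-μ-other k+1≢r k+1≢q)) (≤-trans (part-step desc k) (part≤part-μ k))

  μ-box : ∀ {a j} → j < part μ a → j < part L a ⊎ (a ≡ r × j ≡ q) ⊎ (a ≡ q × j ≡ r)
  μ-box {a} {j} j<p′a with a ≟ r | a ≟ q
  ... | yes refl | _ with m≤n⇒m<n∨m≡n (s≤s⁻¹ (subst (j <_) part-μ-r j<p′a))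
  ...   | inj₁ j<q = inj₁ j<q
  ...   | inj₂ j≡q = inj₂ (inj₁ (refl , j≡q))
  μ-box {a} {j} j<p′a | no _ | yes refl with m≤n⇒m<n∨m≡n (s≤s⁻¹ (subst (j <_) part-μ-q j<p′a))
  ...   | inj₁ j<r = inj₁ (subst (j <_) (sym pq≡r) j<r)
  ...   | inj₂ j≡r = inj₂ (inj₂ (refl , j≡r))
  μ-box {a} {j} j<p′a | no a≢r | no a≢q = inj₁ (subst (j <_) (part-μ-other a≢r a≢q) j<p′a)

  selfConjugate-μ : SelfConjugate μ
  selfConjugate-μ = selfConjugate-from-transpose descending-μ transpose-μ
    where
    transpose-μ : ∀ {a j} → j < part μ a → a < part μ j
    transpose-μ {a} {j} j<p′a with μ-box j<p′a
    ... | inj₁ j<pa                 = <-≤-trans (transpose desc sc j<pa) (part≤part-μ j)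
    ... | inj₂ (inj₁ (refl , refl)) = subst (r <_) (sym part-μ-q) (n<1+n r)
    ... | inj₂ (inj₂ (refl , refl)) = subst (q <_) (sym part-μ-r) (n<1+n q)

  strictDiagonal-μ : StrictDiagonal μ
  strictDiagonal-μ {a} {b} a<b b<p′b with b ≟ r | b ≟ q
  ... | yes refl | _ = subst (_< part μ a) (sym part-μ-r)
                         (<-≤-trans q+1<pi (≤-trans (part-antitone desc (s≤s⁻¹ a<b)) (part≤part-μ a)))
  ... | no _ | yes refl = ⊥-elim (<⇒≱ r<q (s≤s⁻¹ (subst (q <_) part-μ-q b<p′b)))
  ... | no b≢r | no b≢q rewrite part-μ-other b≢r b≢q =
    <-≤-trans (strictDiag a<b b<p′b) (part≤part-μ a)

  size-μ : size μ ≡ suc (suc (size L))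
  size-μ = trans (size-incAt (incAt r L) q (subst (q <_) (sym (length-incAt L r)) q<length))
                 (cong suc (size-incAt L r r<length))

  positive-μ : All (0 <_) L → All (0 <_) μ
  positive-μ pos = All-pos-incAt (incAt r L) q (All-pos-incAt L r pos)

module MaximalityArgument {t : ℕ} {L : List ℕ} (2≤t : 2 ≤ t)
    (desc : Descending L) (pos : All (0 <_) L) (core : IsCore t L) (core′ : IsCore (suc t) L)
    (sc : SelfConjugate L) (distinct : FirstSDistinct L)
    (i : ℕ) (r<s : suc i < s L)
    (hi≤2t-1 : hook L i i ≤ 2 * t ∸ 1) (t+2≤hr : t + 2 ≤ hook L (suc i) (suc i))
    (gap : hook L i i ∸ hook L (suc i) (suc i) ≡ 6) where

  r q hr hi : ℕ
  r = suc i
  q = part L r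
  hr = hook L r r
  hi = hook L i i

  strictDiag : StrictDiagonal L
  strictDiag = firstSDistinct⇒strictDiagonal desc distinct

  diagonal-hook : ∀ {a} → a < s L → hook L a a + (a + a + 1) ≡ part L a + part L a
  diagonal-hook a<s = hook-sum desc sc (<s⇒<part desc a<s)

  hi≡6+hr : hi ≡ 6 + hr
  hi≡6+hr = trans (sym (m∸n+n≡m hr≤hi)) (cong (_+ hr) gap)
    where
    hr≤hi : hr ≤ hi
    hr≤hi = ≮⇒≥ λ hi<hr → contradiction (trans (sym (m≤n⇒m∸n≡0 (<⇒≤ hi<hr))) gap) λ ()

  r<q : r < q
  r<q = <s⇒<part desc r<s

  pi≡q+2 : part L i ≡ q + 2
  pi≡q+2 = +-double-injective (begin
    part L i + part L i         ≡⟨ sym (diagonal-hook (<-trans (n<1+n i) r<s)) ⟩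
    hi + (i + i + 1)            ≡⟨ cong (_+ (i + i + 1)) hi≡6+hr ⟩
    6 + hr + (i + i + 1)        ≡⟨ rearrange hr i ⟩
    hr + (r + r + 1) + 4        ≡⟨ cong (_+ 4) (diagonal-hook r<s) ⟩
    q + q + 4                   ≡⟨ regroup q ⟩
    (q + 2) + (q + 2)           ∎)
    where
    open ≡-Reasoning
    rearrange : ∀ h i → 6 + h + (i + i + 1) ≡ h + (suc i + suc i + 1) + 4
    rearrange = solve-∀
    regroup : ∀ q → q + q + 4 ≡ (q + 2) + (q + 2)
    regroup = solve-∀

  c : ℕ
  c = q ∸ r

  c+r≡q : c + r ≡ q
  c+r≡q = m∸n+n≡m (<⇒≤ r<q)

  hr+1≡c+c : hr + 1 ≡ c + c
  hr+1≡c+c = +-cancelʳ-≡ (r + r) _ _ (begin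
    hr + 1 + (r + r)            ≡⟨ rearrange hr r ⟩
    hr + (r + r + 1)            ≡⟨ diagonal-hook r<s ⟩
    q + q                       ≡⟨ cong₂ _+_ (sym c+r≡q) (sym c+r≡q) ⟩
    (c + r) + (c + r)           ≡⟨ regroup c r ⟩
    c + c + (r + r)             ∎)
    where
    open ≡-Reasoning
    rearrange : ∀ h r → h + 1 + (r + r) ≡ h + (r + r + 1)
    rearrange = solve-∀
    regroup : ∀ c r → (c + r) + (c + r) ≡ c + c + (r + r)
    regroup = solve-∀

  t+3≤c+c : t + 3 ≤ c + c
  t+3≤c+c = subst₂ _≤_ (+-assoc t 2 1) hr+1≡c+c (+-monoˡ-≤ 1 t+2≤hr)

  c+c+6≤t+t : c + c + 6 ≤ t + t
  c+c+6≤t+t = begin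
    c + c + 6                   ≡⟨ cong (_+ 6) (sym hr+1≡c+c) ⟩
    hr + 1 + 6                  ≡⟨ rearrange hr ⟩
    6 + hr + 1                  ≡⟨ cong (_+ 1) (sym hi≡6+hr) ⟩
    hi + 1                      ≤⟨ m≤o∸n⇒m+n≤o hi (≤-trans (≤-trans (s≤s z≤n) 2≤t) (m≤m+n t (t + 0))) hi≤2t-1 ⟩
    2 * t                       ≡⟨ cong (t +_) (+-identityʳ t) ⟩
    t + t                       ∎
    where
    open ≤-Reasoning
    rearrange : ∀ h → h + 1 + 6 ≡ 6 + h + 1
    rearrange = solve-∀

  c+3≤t : c + 3 ≤ t
  c+3≤t = ≮⇒≥ λ t<c+3 → <⇒≱ (+-mono-< t<c+3 t<c+3) (subst (_≤ t + t) (regroup c) c+c+6≤t+t)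
    where
    regroup : ∀ c → c + c + 6 ≡ (c + 3) + (c + 3)
    regroup = solve-∀

  0<c : 0 < c
  0<c = n≢0⇒n>0 λ c≡0 → contradiction (m+n≤o⇒n≤o t (subst (λ x → t + 3 ≤ x + x) c≡0 t+3≤c+c)) λ ()

  part≤+t : ∀ j → part L j ≤ j + t
  part≤+t j = ≤-trans (part-antitone desc z≤n)
                      (≤-trans (first-part≤ desc sc strictDiag core core′ (≤-trans (s≤s z≤n) 2≤t)) (m≤n+m t j))

  -- Target j says that (j, j) is a diagonal box with hook 2t + 4 − hi
  Target : ℕ → Set
  Target j = part L j + c ≡ t + j

  c<t : c < t
  c<t = <-≤-trans (m<m+n c (s≤s z≤n)) c+3≤t

  target-in-durfee : ∀ {j} → Target j → j < part L j
  target-in-durfee {j} target = +-cancelʳ-≤ c (suc j) (part L j) (begin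
    suc j + c                   ≡⟨ sym (+-suc j c) ⟩
    j + suc c                   ≤⟨ +-monoʳ-≤ j c<t ⟩
    j + t                       ≡⟨ +-comm j t ⟩
    t + j                       ≡⟨ sym target ⟩
    part L j + c                ∎)
    where open ≤-Reasoning

  target⇒InMD : ∀ {j} → Target j → InMD L (2 * t + 4 ∸ hi)
  target⇒InMD {j} target = j , <part⇒<s desc j<pj , sym (trans (cong (_∸ hi) 2t+4≡H+hi) (m+n∸n≡m H hi))
    where
    open ≡-Reasoning
    j<pj : j < part L j
    j<pj = target-in-durfee target
    H : ℕ
    H = hook L j j
    H+c+c+1≡t+t : H + (c + c + 1) ≡ t + t
    H+c+c+1≡t+t = +-cancelʳ-≡ (j + j) _ _ (begin
      H + (c + c + 1) + (j + j)     ≡⟨ rearrange H c j ⟩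
      H + (j + j + 1) + (c + c)     ≡⟨ cong (_+ (c + c)) (hook-sum desc sc j<pj) ⟩
      part L j + part L j + (c + c) ≡⟨ regroup (part L j) c ⟩
      (part L j + c) + (part L j + c) ≡⟨ cong₂ _+_ target target ⟩
      (t + j) + (t + j)             ≡⟨ sym (regroup t j) ⟩
      (t + t) + (j + j)             ∎)
      where
      rearrange : ∀ H c j → H + (c + c + 1) + (j + j) ≡ H + (j + j + 1) + (c + c)
      rearrange = solve-∀
      regroup : ∀ x y → x + x + (y + y) ≡ (x + y) + (x + y)
      regroup = solve-∀
    2t+4≡H+hi : 2 * t + 4 ≡ H + hi
    2t+4≡H+hi = begin
      2 * t + 4                     ≡⟨ cong (λ x → t + x + 4) (+-identityʳ t) ⟩
      t + t + 4                     ≡⟨ cong (_+ 4) (sym H+c+c+1≡t+t) ⟩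
      H + (c + c + 1) + 4           ≡⟨ cong (λ x → H + (x + 1) + 4) (sym hr+1≡c+c) ⟩
      H + (hr + 1 + 1) + 4          ≡⟨ rearrange H hr ⟩
      H + (6 + hr)                  ≡⟨ cong (H +_) (sym hi≡6+hr) ⟩
      H + hi                        ∎
      where
      rearrange : ∀ H h → H + (h + 1 + 1) + 4 ≡ H + (6 + h)
      rearrange = solve-∀

  q+1<pi : suc q < part L i
  q+1<pi = subst (suc q <_) (trans (+-comm 2 q) (sym pi≡q+2)) (n<1+n (suc q))

  open AddSymmetricCorners desc sc strictDiag i r<q q+1<pi
    using (μ; part-μ-r; part-μ-q; part-μ-other; descending-μ; selfConjugate-μ; strictDiagonal-μ; positive-μ; size-μ)

  transpose-μ : ∀ {a j} → j < part μ a → a < part μ j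
  transpose-μ = transpose descending-μ selfConjugate-μ

  hook-μ : ∀ {a j} → j < part μ a → hook μ a j + (a + j + 1) ≡ part μ a + part μ j
  hook-μ = hook-sum descending-μ selfConjugate-μ

  hook-μ-sym : ∀ {a j} → j < part μ a → hook μ a j ≡ hook μ j a
  hook-μ-sym = hook-sym descending-μ selfConjugate-μ

  hook-μ-r-q≡1 : hook μ r q ≡ 1
  hook-μ-r-q≡1 = +-cancelʳ-≡ (r + q + 1) _ _ (begin
    hook μ r q + (r + q + 1)     ≡⟨ hook-μ (subst (q <_) (sym part-μ-r) (n<1+n q)) ⟩
    part μ r + part μ q          ≡⟨ cong₂ _+_ part-μ-r part-μ-q ⟩
    suc q + suc r                ≡⟨ rearrange q r ⟩
    1 + (r + q + 1)              ∎)
    where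
    open ≡-Reasoning
    rearrange : ∀ q r → suc q + suc r ≡ 1 + (r + q + 1)
    rearrange = solve-∀

  avoids-1 : Avoids t 1
  avoids-1 = avoids-below (s≤s z≤n) 2≤t

  avoids-μ-r-r : Avoids t (hook μ r r)
  avoids-μ-r-r = avoids-below-double (hook-pos μ r r) v<t+t
                   (λ v≡t → <⇒≢ (<-trans (n<1+n t) 1+t<v) (sym v≡t)) (λ v≡1+t → <⇒≢ 1+t<v (sym v≡1+t))
    where
    v : ℕ
    v = hook μ r r
    v≡c+c+1 : v ≡ c + c + 1
    v≡c+c+1 = +-cancelʳ-≡ (r + r + 1) _ _ (begin
      v + (r + r + 1)            ≡⟨ hook-μ (subst (r <_) (sym part-μ-r) (m<n⇒m<1+n r<q)) ⟩
      part μ r + part μ r        ≡⟨ cong₂ _+_ part-μ-r part-μ-r ⟩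
      suc q + suc q              ≡⟨ cong₂ (λ x y → suc x + suc y) (sym c+r≡q) (sym c+r≡q) ⟩
      suc (c + r) + suc (c + r)  ≡⟨ rearrange c r ⟩
      c + c + 1 + (r + r + 1)    ∎)
      where
      open ≡-Reasoning
      rearrange : ∀ c r → suc (c + r) + suc (c + r) ≡ c + c + 1 + (r + r + 1)
      rearrange = solve-∀
    1+t<v : suc t < v
    1+t<v = subst (suc t <_) (sym v≡c+c+1)
      (≤-trans (≤-trans (n≤1+n (suc (suc t))) (subst (_≤ c + c) (+-comm t 3) t+3≤c+c)) (m≤m+n (c + c) 1))
    v<t+t : v < t + t
    v<t+t = subst (_< t + t) (sym v≡c+c+1) (<-≤-trans (+-monoʳ-< (c + c) (s≤s (s≤s z≤n))) c+c+6≤t+t)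

  avoids-μ-r-other : (∀ j → ¬ Target j) → ∀ {j} → j < part μ r → j ≢ r → j ≢ q → Avoids t (hook μ r j)
  avoids-μ-r-other no-target {j} j<p′r j≢r j≢q = avoids-below-double (hook-pos μ r j) v<t+t v≢t v≢1+t
    where
    v : ℕ
    v = hook μ r j
    j<q : j < q
    j<q = ≤∧≢⇒< (s≤s⁻¹ (subst (j <_) part-μ-r j<p′r)) j≢q
    v+r+j+1≡ : v + (r + j + 1) ≡ suc q + part L j
    v+r+j+1≡ = trans (hook-μ j<p′r) (cong₂ _+_ part-μ-r (part-μ-other j≢r j≢q))
    v≡1+hook : v ≡ suc (hook L r j)
    v≡1+hook = +-cancelʳ-≡ (r + j + 1) _ _ (trans v+r+j+1≡ (cong suc (sym (hook-sum desc sc j<q))))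
    v+j≡c+pj : v + j ≡ c + part L j
    v+j≡c+pj = +-cancelʳ-≡ (suc r) _ _ (begin
      v + j + suc r              ≡⟨ rearrange v j r ⟩
      v + (r + j + 1)            ≡⟨ v+r+j+1≡ ⟩
      suc q + part L j           ≡⟨ cong (λ x → suc x + part L j) (sym c+r≡q) ⟩
      suc (c + r) + part L j     ≡⟨ rearrange′ c r (part L j) ⟩
      c + part L j + suc r       ∎)
      where
      open ≡-Reasoning
      rearrange : ∀ v j r → v + j + suc r ≡ v + (r + j + 1)
      rearrange = solve-∀
      rearrange′ : ∀ c r p → suc (c + r) + p ≡ c + p + suc r
      rearrange′ = solve-∀
    v<t+t : v < t + t
    v<t+t = +-cancelʳ-< j v (t + t) (begin-strict
      v + j                      ≡⟨ v+j≡c+pj ⟩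
      c + part L j               ≤⟨ +-monoʳ-≤ c (part≤+t j) ⟩
      c + (j + t)                <⟨ +-monoˡ-< (j + t) c<t ⟩
      t + (j + t)                ≡⟨ rearrange t j ⟩
      t + t + j                  ∎)
      where
      open ≤-Reasoning
      rearrange : ∀ t j → t + (j + t) ≡ t + t + j
      rearrange = solve-∀
    v≢t : v ≢ t
    v≢t v≡t = no-target j (trans (+-comm (part L j) c) (trans (sym v+j≡c+pj) (cong (_+ j) v≡t)))
    v≢1+t : v ≢ suc t
    v≢1+t v≡1+t = core r j j<q (subst (t ∣_) (suc-injective (trans (sym v≡1+t) v≡1+hook)) ∣-refl)

  avoids-μ-q-other : ∀ {j} → j < part μ q → j ≢ r → j ≢ q → Avoids t (hook μ q j)
  avoids-μ-q-other {j} j<p′q j≢r j≢q = avoids-below (hook-pos μ q j) (<-≤-trans (m<m+n v 0<c) v+c≤t)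
    where
    v : ℕ
    v = hook μ q j
    v+c≤t : v + c ≤ t
    v+c≤t = +-cancelʳ-≤ (r + j + 1) (v + c) t (begin
      v + c + (r + j + 1)        ≡⟨ rearrange v c r j ⟩
      v + ((c + r) + j + 1)      ≡⟨ cong (λ x → v + (x + j + 1)) c+r≡q ⟩
      v + (q + j + 1)            ≡⟨ hook-μ j<p′q ⟩
      part μ q + part μ j        ≡⟨ cong₂ _+_ part-μ-q (part-μ-other j≢r j≢q) ⟩
      suc r + part L j           ≤⟨ +-monoʳ-≤ (suc r) (part≤+t j) ⟩
      suc r + (j + t)            ≡⟨ rearrange′ r j t ⟩
      t + (r + j + 1)            ∎)
      where
      open ≤-Reasoning
      rearrange : ∀ v c r j → v + c + (r + j + 1) ≡ v + ((c + r) + j + 1)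
      rearrange = solve-∀
      rearrange′ : ∀ r j t → suc r + (j + t) ≡ t + (r + j + 1)
      rearrange′ = solve-∀

  avoids-row-r : (∀ j → ¬ Target j) → ∀ {j} → j < part μ r → Avoids t (hook μ r j)
  avoids-row-r no-target {j} j<p′r with j ≟ r | j ≟ q
  ... | yes refl | _       = avoids-μ-r-r
  ... | no _     | yes refl = subst (Avoids t) (sym hook-μ-r-q≡1) avoids-1
  ... | no j≢r   | no j≢q  = avoids-μ-r-other no-target j<p′r j≢r j≢q

  avoids-row-q : ∀ {j} → j < part μ q → Avoids t (hook μ q j)
  avoids-row-q {j} j<p′q with j ≟ r | j ≟ q
  ... | yes refl | _       = subst (Avoids t) (sym (trans (hook-μ-sym r<p′q) hook-μ-r-q≡1)) avoids-1
    where
    r<p′q : r < part μ q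
    r<p′q = subst (r <_) (sym part-μ-q) (n<1+n r)
  ... | no _     | yes refl = ⊥-elim (<⇒≱ r<q (s≤s⁻¹ (subst (q <_) part-μ-q j<p′q)))
  ... | no j≢r   | no j≢q  = avoids-μ-q-other j<p′q j≢r j≢q

  hook-μ-unchanged : ∀ {a j} → j < part μ a → a ≢ r → a ≢ q → j ≢ r → j ≢ q → hook μ a j ≡ hook L a j
  hook-μ-unchanged {a} {j} j<p′a a≢r a≢q j≢r j≢q = +-cancelʳ-≡ (a + j + 1) _ _ (begin
    hook μ a j + (a + j + 1)   ≡⟨ hook-μ j<p′a ⟩
    part μ a + part μ j        ≡⟨ cong₂ _+_ (part-μ-other a≢r a≢q) (part-μ-other j≢r j≢q) ⟩
    part L a + part L j        ≡⟨ sym (hook-sum desc sc (subst (j <_) (part-μ-other a≢r a≢q) j<p′a)) ⟩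
    hook L a j + (a + j + 1)   ∎)
    where open ≡-Reasoning

  μ-avoids : (∀ j → ¬ Target j) → ∀ {a j} → j < part μ a → Avoids t (hook μ a j)
  μ-avoids no-target {a} {j} j<p′a with a ≟ r | a ≟ q | j ≟ r | j ≟ q
  ... | yes refl | _ | _ | _ = avoids-row-r no-target j<p′a
  ... | no _ | yes refl | _ | _ = avoids-row-q j<p′a
  ... | no _ | no _ | yes refl | _ = subst (Avoids t) (sym (hook-μ-sym j<p′a))
                                       (avoids-row-r no-target (transpose-μ j<p′a))
  ... | no _ | no _ | no _ | yes refl = subst (Avoids t) (sym (hook-μ-sym j<p′a))
                                          (avoids-row-q (transpose-μ j<p′a))
  ... | no a≢r | no a≢q | no j≢r | no j≢q = subst (Avoids t) (sym (hook-μ-unchanged j<p′a a≢r a≢q j≢r j≢q))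
                                              (core a j j<pa , core′ a j j<pa)
    where
    j<pa : j < part L a
    j<pa = subst (j <_) (part-μ-other a≢r a≢q) j<p′a

  μ∈DS : (∀ j → ¬ Target j) → DS t μ
  μ∈DS no-target = (descending-μ , positive-μ pos)
                 , (λ a j box → proj₁ (μ-avoids no-target box))
                 , (λ a j box → proj₂ (μ-avoids no-target box))
                 , selfConjugate-μ
                 , strictDiagonal⇒firstSDistinct descending-μ strictDiagonal-μ

  larger-member : (∀ j → ¬ Target j) → ∃ λ ν → DS t ν × size L < size ν
  larger-member no-target = μ , μ∈DS no-target , subst (size L <_) (sym size-μ) (m<n⇒m<1+n (n<1+n (size L)))

  target? : (∃ Target) ⊎ (∀ j → ¬ Target j)
  target? with any? (λ (j : Fin (length L)) → part L (toℕ j) + c ≟ t + toℕ j)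
  ... | yes (j , target) = inj₁ (toℕ j , target)
  ... | no ¬target       = inj₂ λ j target →
    ¬target (fromℕ< (j<length target) , subst Target (sym (toℕ-fromℕ< (j<length target))) target)
    where
    j<length : ∀ {j} → Target j → j < length L
    j<length {j} target = part-pos⇒<length L j (≤-<-trans z≤n (target-in-durfee target))

lemma3p3 : (t : ℕ) → 6 ≤ t → (λs : List ℕ) → DS t λs
    → (∀ μ → DS t μ → size μ ≤ size λs)
    → (i : ℕ) → suc i < s λs
    → InQl t (hook λs i i) → InQl t (hook λs (suc i) (suc i))
    → hook λs i i ∸ hook λs (suc i) (suc i) ≡ 6
    → InMD λs (2 * t + 4 ∸ hook λs i i)
lemma3p3 t 6≤t L ((desc , pos) , core , core′ , sc , distinct) maximal i r<s
         (_ , _ , hi≤2t-1 , _ , _ , _) (_ , _ , _ , _ , _ , t+2≤hr) gap =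
  [ (λ (_ , target) → target⇒InMD target)
  , (λ no-target → let (ν , ν∈DS , L<ν) = larger-member no-target in ⊥-elim (<⇒≱ L<ν (maximal ν ν∈DS)))
  ]′ target?
  where
  open MaximalityArgument (≤-trans (s≤s (s≤s z≤n)) 6≤t) desc pos core core′ sc distinct i r<s hi≤2t-1 t+2≤hr gap
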